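{- For every nonnegative integer $n$, the number $M(0,n)$ of partitions of $n$ with crank $0$ satisfies \[M(0,n)=p(n)+2\sum_{k=1}^\infty(-1)^k p\!\left(n-\frac{k(k+1)}{2}\right)=p(n)-2p(n-1)+2p(n-3)-2p(n-6)+\cdots.\]
   Context: $p(m)$ is the number of partitions of $m$, with $p(0)=1$ and $p(m)=0$ for $m<0$. Write $(q)_\infty=\prod_{i\ge1}(1-q^i)$. $M(m,n)$, the number of partitions of $n$ with crank $m$, is defined by Garvan's generating function \[\sum_{n\ge0}M(m,n)q^n=\frac{1}{(q)_\infty}\sum_{r\ge1}(-1)^{r-1}q^{r(r-1)/2+r|m|}(1-q^r).\] This agrees with the combinatorial crank count except at $n=1$, where $M(0,1)=-1$. -}

module Defs where

open import Data.Nat as ℕ using (ℕ; zero; suc; _∸_; _≤?_; _≟_)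
open import Data.Integer as ℤ using (ℤ; +_; -_; ∣_∣)
open import Relation.Nullary using (yes; no)

sumℕ : ℕ → (ℕ → ℕ) → ℕ
sumℕ zero    f = f 0
sumℕ (suc n) f = sumℕ n f ℕ.+ f (suc n)

sumℤ : ℕ → (ℕ → ℤ) → ℤ
sumℤ zero    f = f 0
sumℤ (suc n) f = sumℤ n f ℤ.+ f (suc n)

sumℤ₁ : ℕ → (ℕ → ℤ) → ℤ
sumℤ₁ zero    f = + 0
sumℤ₁ (suc n) f = sumℤ₁ n f ℤ.+ f (suc n)

sign : ℕ → ℤ
sign zero          = + 1
sign (suc zero)    = - + 1
sign (suc (suc k)) = sign k

-- partsUpTo n k = number of partitions of n into parts of size ≤ k,
-- counted by the multiplicity j of the part k (then the rest is a
-- partition of n - j*k into parts ≤ k-1).  Equivalently the coefficient of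
-- q^n in ∏_{i=1}^{k} 1/(1-q^i).
partsUpTo : ℕ → ℕ → ℕ
partsUpTo zero    zero    = 1
partsUpTo (suc n) zero    = 0
partsUpTo n       (suc k) = sumℕ n term
  where
  term : ℕ → ℕ
  term j with j ℕ.* suc k ≤? n
  ... | yes _ = partsUpTo (n ∸ j ℕ.* suc k) k
  ... | no  _ = 0

p : ℕ → ℕ
p n = partsUpTo n n

-- p(n - t) as an integer, with the convention p(m) = 0 for m < 0.
pShift : ℕ → ℕ → ℤ
pShift n t with t ≤? n
... | yes _ = + p (n ∸ t)
... | no  _ = + 0

δ : ℕ → ℕ → ℤ
δ a b with a ≟ b
... | yes _ = + 1
... | no  _ = + 0

-- coefficient of q^j in  Σ_{r≥1} (-1)^{r-1} q^{r(r-1)/2 + r|m|} (1 - q^r).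
-- Only r ≤ j+1 can contribute, since r(r-1)/2 ≥ r - 1.
crankNumCoeff : ℤ → ℕ → ℤ
crankNumCoeff m j = sumℤ₁ (suc j) term
  where
  e : ℕ → ℕ
  e r = (r ℕ.* (r ∸ 1)) ℕ./ 2 ℕ.+ r ℕ.* ∣ m ∣
  term : ℕ → ℤ
  term r = sign (r ∸ 1) ℤ.* (δ (e r) j ℤ.- δ (e r ℕ.+ r) j)

invEulerCoeff : ℕ → ℤ
invEulerCoeff n = + p n

-- M(m,n): coefficient of q^n in Garvan's generating function
--   (1/(q)_∞) Σ_{r≥1} (-1)^{r-1} q^{r(r-1)/2 + r|m|} (1 - q^r)
-- (Cauchy product of the two series).
M : ℤ → ℕ → ℤ
M m n = sumℤ n (λ j → invEulerCoeff (n ∸ j) ℤ.* crankNumCoeff m j)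

-- Cauchy-multiplying 1/(q)_∞ with the crank numerator at m = 0 gives
-- M(0,n) = Σ_{r≥1} (-1)^{r-1} (p(n - T(r-1)) - p(n - T r)) with T k = k(k+1)/2,
-- because q^{T(r-1)} and q^{T(r-1)+r} = q^{T r} sift out single values of p.
-- This alternating sum of differences telescopes: every p(n - T k) with k ≥ 1
-- appears twice with sign (-1)^k, and the tail vanishes once T k > n.
module Submission where

open import Defs
open import Data.Nat using (ℕ; suc; _*_; _/_)
open import Data.Integer using (ℤ; +_; _+_)
open import Relation.Binary.PropositionalEquality using (_≡_)

open import Data.Nat as ℕ using (zero; _≤_; _<_; z≤n; s≤s; _≤?_; _≟_; _∸_)
import Data.Nat.Properties as ℕ
open import Data.Nat.DivMod using (m*n/n≡m; +-distrib-/-∣ˡ)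
open import Data.Nat.Divisibility using (divides-refl)
open import Data.Integer as ℤ using (_-_; -_)
import Data.Integer.Properties as ℤ
open import Data.Integer.Tactic.RingSolver using (solve-∀)
open import Data.Empty using (⊥-elim)
open import Data.Sum using (inj₁; inj₂)
open import Relation.Binary.PropositionalEquality
  using (refl; sym; trans; cong; cong₂; _≢_; module ≡-Reasoning)
open import Relation.Nullary using (yes; no)

δ-refl : ∀ a → δ a a ≡ + 1
δ-refl a with a ≟ a
... | yes _  = refl
... | no a≢a = ⊥-elim (a≢a refl)

δ-≢ : ∀ {a b} → a ≢ b → δ a b ≡ + 0
δ-≢ {a} {b} a≢b with a ≟ b
... | yes a≡b = ⊥-elim (a≢b a≡b)
... | no _    = refl

δ-> : ∀ {a b} → b < a → δ a b ≡ + 0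
δ-> b<a = δ-≢ (λ { refl → ℕ.<-irrefl refl b<a })

δ-< : ∀ {a b} → a < b → δ a b ≡ + 0
δ-< a<b = δ-≢ (λ { refl → ℕ.<-irrefl refl a<b })

sumℤ-cong : ∀ n {f g : ℕ → ℤ} → (∀ j → j ≤ n → f j ≡ g j) → sumℤ n f ≡ sumℤ n g
sumℤ-cong zero    f≗g = f≗g 0 z≤n
sumℤ-cong (suc n) f≗g =
  cong₂ _+_ (sumℤ-cong n (λ j j≤n → f≗g j (ℕ.m≤n⇒m≤1+n j≤n))) (f≗g (suc n) ℕ.≤-refl)

sumℤ₁-cong : ∀ n {f g : ℕ → ℤ} → (∀ k → k < n → f (suc k) ≡ g (suc k)) → sumℤ₁ n f ≡ sumℤ₁ n g
sumℤ₁-cong zero    f≗g = refl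
sumℤ₁-cong (suc n) f≗g =
  cong₂ _+_ (sumℤ₁-cong n (λ k k<n → f≗g k (ℕ.m≤n⇒m≤1+n k<n))) (f≗g n ℕ.≤-refl)

sumℤ₁-vanishing-tail : ∀ m n (f : ℕ → ℤ) → (∀ r → m < r → f r ≡ + 0) → m ≤ n →
                       sumℤ₁ n f ≡ sumℤ₁ m f
sumℤ₁-vanishing-tail m zero    f tail z≤n = refl
sumℤ₁-vanishing-tail m (suc n) f tail m≤1+n with ℕ.m≤n⇒m<n∨m≡n m≤1+n
... | inj₂ refl       = refl
... | inj₁ (s≤s m≤n) = trans (cong₂ _+_ (sumℤ₁-vanishing-tail m n f tail m≤n) (tail (suc n) (s≤s m≤n)))
                              (ℤ.+-identityʳ _)

*-distribˡ-sumℤ : ∀ n c (f : ℕ → ℤ) → c ℤ.* sumℤ n f ≡ sumℤ n (λ j → c ℤ.* f j)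
*-distribˡ-sumℤ zero    c f = refl
*-distribˡ-sumℤ (suc n) c f =
  trans (ℤ.*-distribˡ-+ c (sumℤ n f) (f (suc n))) (cong (_+ c ℤ.* f (suc n)) (*-distribˡ-sumℤ n c f))

*-distribˡ-sumℤ₁ : ∀ n c (f : ℕ → ℤ) → c ℤ.* sumℤ₁ n f ≡ sumℤ₁ n (λ j → c ℤ.* f j)
*-distribˡ-sumℤ₁ zero    c f = ℤ.*-zeroʳ c
*-distribˡ-sumℤ₁ (suc n) c f =
  trans (ℤ.*-distribˡ-+ c (sumℤ₁ n f) (f (suc n))) (cong (_+ c ℤ.* f (suc n)) (*-distribˡ-sumℤ₁ n c f))

sumℤ-distrib-+ : ∀ n (f g : ℕ → ℤ) → sumℤ n (λ j → f j + g j) ≡ sumℤ n f + sumℤ n g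
sumℤ-distrib-+ zero    f g = refl
sumℤ-distrib-+ (suc n) f g =
  trans (cong (_+ (f (suc n) + g (suc n))) (sumℤ-distrib-+ n f g))
        (interchange (sumℤ n f) (sumℤ n g) (f (suc n)) (g (suc n)))
  where
  interchange : ∀ a b c d → (a + b) + (c + d) ≡ (a + c) + (b + d)
  interchange = solve-∀

sumℤ-distrib-- : ∀ n (f g : ℕ → ℤ) → sumℤ n (λ j → f j - g j) ≡ sumℤ n f - sumℤ n g
sumℤ-distrib-- zero    f g = refl
sumℤ-distrib-- (suc n) f g =
  trans (cong (_+ (f (suc n) - g (suc n))) (sumℤ-distrib-- n f g))
        (interchange (sumℤ n f) (sumℤ n g) (f (suc n)) (g (suc n)))
  where
  interchange : ∀ a b c d → (a - b) + (c - d) ≡ (a + c) - (b + d)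
  interchange = solve-∀

sumℤ-zero : ∀ n → sumℤ n (λ _ → + 0) ≡ + 0
sumℤ-zero zero    = refl
sumℤ-zero (suc n) = cong (_+ + 0) (sumℤ-zero n)

sumℤ-sumℤ₁-comm : ∀ n m (g : ℕ → ℕ → ℤ) →
                  sumℤ n (λ j → sumℤ₁ m (g j)) ≡ sumℤ₁ m (λ r → sumℤ n (λ j → g j r))
sumℤ-sumℤ₁-comm n zero    g = sumℤ-zero n
sumℤ-sumℤ₁-comm n (suc m) g =
  trans (sumℤ-distrib-+ n (λ j → sumℤ₁ m (g j)) (λ j → g j (suc m)))
        (cong (_+ sumℤ n (λ j → g j (suc m))) (sumℤ-sumℤ₁-comm n m g))

sumℤ-*δ-> : ∀ n a (f : ℕ → ℤ) → n < a → sumℤ n (λ j → f j ℤ.* δ a j) ≡ + 0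
sumℤ-*δ-> n a f n<a = trans (sumℤ-cong n vanish) (sumℤ-zero n)
  where
  vanish : ∀ j → j ≤ n → f j ℤ.* δ a j ≡ + 0
  vanish j j≤n = trans (cong (f j ℤ.*_) (δ-> (ℕ.≤-<-trans j≤n n<a))) (ℤ.*-zeroʳ (f j))

sumℤ-*δ-≤ : ∀ n a (f : ℕ → ℤ) → a ≤ n → sumℤ n (λ j → f j ℤ.* δ a j) ≡ f a
sumℤ-*δ-≤ zero zero f z≤n = trans (cong (f 0 ℤ.*_) (δ-refl 0)) (ℤ.*-identityʳ (f 0))
sumℤ-*δ-≤ (suc n) a f a≤1+n with ℕ.m≤n⇒m<n∨m≡n a≤1+n
... | inj₂ refl =
  trans (cong₂ _+_ (sumℤ-*δ-> n (suc n) f ℕ.≤-refl) (cong (f (suc n) ℤ.*_) (δ-refl (suc n))))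
        (trans (ℤ.+-identityˡ _) (ℤ.*-identityʳ (f (suc n))))
... | inj₁ (s≤s a≤n) =
  trans (cong₂ _+_ (sumℤ-*δ-≤ n a f a≤n)
                   (trans (cong (f (suc n) ℤ.*_) (δ-< (s≤s a≤n))) (ℤ.*-zeroʳ (f (suc n)))))
        (ℤ.+-identityʳ (f a))

sumℤ-p*δ : ∀ n t → sumℤ n (λ j → + p (n ∸ j) ℤ.* δ t j) ≡ pShift n t
sumℤ-p*δ n t with t ≤? n
... | yes t≤n = sumℤ-*δ-≤ n t (λ j → + p (n ∸ j)) t≤n
... | no  t≰n = sumℤ-*δ-> n t (λ j → + p (n ∸ j)) (ℕ.≰⇒> t≰n)

sign-suc : ∀ k → sign (suc k) ≡ - sign k
sign-suc zero          = refl
sign-suc (suc zero)    = refl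
sign-suc (suc (suc k)) = sign-suc k

sumℤ₁-alternating-differences : ∀ (Q : ℕ → ℤ) N →
  sumℤ₁ (suc N) (λ r → sign (r ∸ 1) ℤ.* (Q (r ∸ 1) - Q r))
  ≡ Q 0 + + 2 ℤ.* sumℤ₁ N (λ k → sign k ℤ.* Q k) + sign (suc N) ℤ.* Q (suc N)
sumℤ₁-alternating-differences Q zero = base (Q 0) (Q 1)
  where
  base : ∀ x y → + 0 + + 1 ℤ.* (x - y) ≡ x + + 2 ℤ.* + 0 + (- + 1) ℤ.* y
  base = solve-∀
sumℤ₁-alternating-differences Q (suc N) = begin
  sumℤ₁ (suc N) (λ r → sign (r ∸ 1) ℤ.* (Q (r ∸ 1) - Q r)) + sign (suc N) ℤ.* (Q (suc N) - Q (suc (suc N)))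
    ≡⟨ cong (_+ sign (suc N) ℤ.* (Q (suc N) - Q (suc (suc N)))) (sumℤ₁-alternating-differences Q N) ⟩
  Q 0 + + 2 ℤ.* S + sign (suc N) ℤ.* Q (suc N) + sign (suc N) ℤ.* (Q (suc N) - Q (suc (suc N)))
    ≡⟨ cong (λ s → Q 0 + + 2 ℤ.* S + s ℤ.* Q (suc N) + s ℤ.* (Q (suc N) - Q (suc (suc N)))) (sign-suc N) ⟩
  Q 0 + + 2 ℤ.* S + (- sign N) ℤ.* Q (suc N) + (- sign N) ℤ.* (Q (suc N) - Q (suc (suc N)))
    ≡⟨ step (Q 0) S (sign N) (Q (suc N)) (Q (suc (suc N))) ⟩
  Q 0 + + 2 ℤ.* (S + (- sign N) ℤ.* Q (suc N)) + sign N ℤ.* Q (suc (suc N))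
    ≡⟨ cong (λ s → Q 0 + + 2 ℤ.* (S + s ℤ.* Q (suc N)) + sign N ℤ.* Q (suc (suc N))) (sym (sign-suc N)) ⟩
  Q 0 + + 2 ℤ.* (S + sign (suc N) ℤ.* Q (suc N)) + sign N ℤ.* Q (suc (suc N)) ∎
  where
  open ≡-Reasoning
  S = sumℤ₁ N (λ k → sign k ℤ.* Q k)
  step : ∀ q₀ S s x y → q₀ + + 2 ℤ.* S + (- s) ℤ.* x + (- s) ℤ.* (x - y)
                      ≡ q₀ + + 2 ℤ.* (S + (- s) ℤ.* x) + s ℤ.* y
  step = solve-∀

triangle : ℕ → ℕ
triangle k = (k * suc k) / 2

triangle-suc : ∀ k → triangle (suc k) ≡ suc k ℕ.+ triangle k
triangle-suc k = begin
  (suc k * (2 ℕ.+ k)) / 2          ≡⟨ cong (_/ 2) (ℕ.*-distribˡ-+ (suc k) 2 k) ⟩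
  (suc k * 2 ℕ.+ suc k * k) / 2    ≡⟨ +-distrib-/-∣ˡ (suc k * k) (divides-refl (suc k)) ⟩
  suc k * 2 / 2 ℕ.+ suc k * k / 2  ≡⟨ cong₂ ℕ._+_ (m*n/n≡m (suc k) 2) (cong (_/ 2) (ℕ.*-comm (suc k) k)) ⟩
  suc k ℕ.+ triangle k             ∎
  where open ≡-Reasoning

n<triangle[1+n] : ∀ n → n < triangle (suc n)
n<triangle[1+n] n = ℕ.≤-trans (ℕ.m≤m+n (suc n) (triangle n)) (ℕ.≤-reflexive (sym (triangle-suc n)))

-- Spelled exactly as the exponent inside crankNumCoeff (hence the r * 0), so that
-- M (+ 0) n unfolds definitionally to a sum of crank₀Term.
crank₀Exponent : ℕ → ℕ
crank₀Exponent r = (r * (r ∸ 1)) / 2 ℕ.+ r * 0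

crank₀Exponent-suc : ∀ k → crank₀Exponent (suc k) ≡ triangle k
crank₀Exponent-suc k =
  trans (cong₂ ℕ._+_ (cong (_/ 2) (ℕ.*-comm (suc k) k)) (ℕ.*-zeroʳ (suc k))) (ℕ.+-identityʳ _)

crank₀Exponent-suc+suc : ∀ k → crank₀Exponent (suc k) ℕ.+ suc k ≡ triangle (suc k)
crank₀Exponent-suc+suc k =
  trans (cong (ℕ._+ suc k) (crank₀Exponent-suc k)) (trans (ℕ.+-comm (triangle k) (suc k)) (sym (triangle-suc k)))

crank₀Term : ℕ → ℕ → ℤ
crank₀Term j r = sign (r ∸ 1) ℤ.* (δ (crank₀Exponent r) j - δ (crank₀Exponent r ℕ.+ r) j)

crank₀Term-vanishing : ∀ j r → suc j < r → crank₀Term j r ≡ + 0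
crank₀Term-vanishing j (suc (suc k)) (s≤s (s≤s j≤k)) =
  trans (cong (sign (suc k) ℤ.*_) (cong₂ _-_ (δ-> j<e) (δ-> (ℕ.≤-trans j<e (ℕ.m≤m+n _ _)))))
        (ℤ.*-zeroʳ (sign (suc k)))
  where
  j<e : j < crank₀Exponent (suc (suc k))
  j<e = ℕ.≤-trans (s≤s j≤k) (ℕ.≤-trans (n<triangle[1+n] k) (ℕ.≤-reflexive (sym (crank₀Exponent-suc (suc k)))))

sumℤ-p*crank₀Term : ∀ n k → sumℤ n (λ j → + p (n ∸ j) ℤ.* crank₀Term j (suc k))
                            ≡ sign k ℤ.* (pShift n (triangle k) - pShift n (triangle (suc k)))
sumℤ-p*crank₀Term n k = begin
  sumℤ n (λ j → P j ℤ.* (sign k ℤ.* (δ e j - δ e′ j)))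
    ≡⟨ sumℤ-cong n (λ j _ → rearrange (P j) (sign k) (δ e j) (δ e′ j)) ⟩
  sumℤ n (λ j → sign k ℤ.* (P j ℤ.* δ e j - P j ℤ.* δ e′ j))
    ≡⟨ sym (*-distribˡ-sumℤ n (sign k) _) ⟩
  sign k ℤ.* sumℤ n (λ j → P j ℤ.* δ e j - P j ℤ.* δ e′ j)
    ≡⟨ cong (sign k ℤ.*_) (sumℤ-distrib-- n _ _) ⟩
  sign k ℤ.* (sumℤ n (λ j → P j ℤ.* δ e j) - sumℤ n (λ j → P j ℤ.* δ e′ j))
    ≡⟨ cong (sign k ℤ.*_) (cong₂ _-_ (sumℤ-p*δ n e) (sumℤ-p*δ n e′)) ⟩
  sign k ℤ.* (pShift n e - pShift n e′)
    ≡⟨ cong (λ x → sign k ℤ.* x)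
            (cong₂ _-_ (cong (pShift n) (crank₀Exponent-suc k)) (cong (pShift n) (crank₀Exponent-suc+suc k))) ⟩
  sign k ℤ.* (pShift n (triangle k) - pShift n (triangle (suc k))) ∎
  where
  open ≡-Reasoning
  P : ℕ → ℤ
  P j = + p (n ∸ j)
  e e′ : ℕ
  e  = crank₀Exponent (suc k)
  e′ = crank₀Exponent (suc k) ℕ.+ suc k
  rearrange : ∀ x s u v → x ℤ.* (s ℤ.* (u - v)) ≡ s ℤ.* (x ℤ.* u - x ℤ.* v)
  rearrange = solve-∀

pShift-triangle[1+n] : ∀ n → pShift n (triangle (suc n)) ≡ + 0
pShift-triangle[1+n] n with triangle (suc n) ≤? n
... | yes T≤n = ⊥-elim (ℕ.<-irrefl refl (ℕ.<-≤-trans (n<triangle[1+n] n) T≤n))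
... | no  _   = refl

corollary6 : (n : ℕ) →
    M (+ 0) n ≡ + p n + (+ 2) Data.Integer.* sumℤ₁ n (λ k → sign k Data.Integer.* pShift n ((k * suc k) / 2))
corollary6 n = begin
  sumℤ n (λ j → P j ℤ.* sumℤ₁ (suc j) (crank₀Term j))
    ≡⟨ sumℤ-cong n (λ j j≤n → cong (P j ℤ.*_)
         (sym (sumℤ₁-vanishing-tail (suc j) (suc n) (crank₀Term j) (crank₀Term-vanishing j) (s≤s j≤n)))) ⟩
  sumℤ n (λ j → P j ℤ.* sumℤ₁ (suc n) (crank₀Term j))
    ≡⟨ sumℤ-cong n (λ j _ → *-distribˡ-sumℤ₁ (suc n) (P j) (crank₀Term j)) ⟩
  sumℤ n (λ j → sumℤ₁ (suc n) (λ r → P j ℤ.* crank₀Term j r))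
    ≡⟨ sumℤ-sumℤ₁-comm n (suc n) (λ j r → P j ℤ.* crank₀Term j r) ⟩
  sumℤ₁ (suc n) (λ r → sumℤ n (λ j → P j ℤ.* crank₀Term j r))
    ≡⟨ sumℤ₁-cong (suc n) (λ k _ → sumℤ-p*crank₀Term n k) ⟩
  sumℤ₁ (suc n) (λ r → sign (r ∸ 1) ℤ.* (Q (r ∸ 1) - Q r))
    ≡⟨ sumℤ₁-alternating-differences Q n ⟩
  Q 0 + + 2 ℤ.* S + sign (suc n) ℤ.* Q (suc n)
    ≡⟨ cong (λ x → Q 0 + + 2 ℤ.* S + sign (suc n) ℤ.* x) (pShift-triangle[1+n] n) ⟩
  Q 0 + + 2 ℤ.* S + sign (suc n) ℤ.* + 0
    ≡⟨ trans (cong (λ x → Q 0 + + 2 ℤ.* S + x) (ℤ.*-zeroʳ (sign (suc n)))) (ℤ.+-identityʳ _) ⟩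
  + p n + + 2 ℤ.* S ∎
  where
  open ≡-Reasoning
  P Q : ℕ → ℤ
  P j = + p (n ∸ j)
  Q k = pShift n (triangle k)
  S = sumℤ₁ n (λ k → sign k ℤ.* Q k)
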